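{- Let $G=(V,E)$ be a connected graph whose number of vertices is divisible by $4$. Let $\{A,B\}$ be a minimum cut or a maximum cut of $G$, with organized partition $\mathcal{C}$ and associated value $D_{\mathcal{C}}$. If $D_{\mathcal{C}}=0$, then $\{A,B\}$ is not the unique minimum cut (respectively, not the unique maximum cut) of $G$.
   Context: For $X,Y\subseteq V$, $E(X,Y)$ denotes the number of edges of $G$ with one endpoint in $X$ and the other in $Y$. A cut (bisection) is a partition $\{A,B\}$ of $V$ with $|A|=|B|$; it is a minimum (resp. maximum) cut if $E(A,B)$ is minimum (resp. maximum) among all bisections. For a bisection $\{A,B\}$, define $$D_{\mathcal{C}}=\min\big\{E(\bar A_1,\bar A_2)+E(\bar B_1,\bar B_2)-E(\bar A_1,\bar B_1)-E(\bar A_2,\bar B_2)\big\},$$ the minimum taken over all decompositions $A=\bar A_1\cup \bar A_2$, $B=\bar B_1\cup\bar B_2$ into disjoint sets with $|\bar A_1|=|\bar A_2|$ and $|\bar B_1|=|\bar B_2|$. Any decomposition attaining this minimum is called an organized partition of $\{A,B\}$. -}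

module Defs where

open import Data.Bool using (Bool; true; false; _∧_; if_then_else_)
open import Data.Nat using (ℕ; zero; suc; _+_; _*_; _≤_)
open import Data.Integer as ℤ using (ℤ; +_)
open import Data.Fin using (Fin)
open import Data.Fin.Subset using (Subset; _∈_; _∉_; ∣_∣; ∁; _∪_; _∩_; ⊥)
open import Data.Vec using (lookup)
open import Data.List using (List; map; allFin)
open import Data.Nat.ListAction using (sum)
open import Data.Product using (Σ; _×_; ∃; _,_)
open import Relation.Binary.PropositionalEquality using (_≡_; _≢_)
open import Relation.Nullary using (¬_)

record Graph (n : ℕ) : Set where
  field
    adj   : Fin n → Fin n → Bool
    sym   : ∀ x y → adj x y ≡ adj y x
    irrfl : ∀ x → adj x x ≡ false
open Graph public

data Reach {n : ℕ} (G : Graph n) : Fin n → Fin n → Set where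
  here : ∀ {x} → Reach G x x
  step : ∀ {x y z} → adj G x y ≡ true → Reach G y z → Reach G x z

Connected : ∀ {n} → Graph n → Set
Connected {n} G = ∀ (x y : Fin n) → Reach G x y

private
  b2n : Bool → ℕ
  b2n true  = 1
  b2n false = 0

-- E(X,Y): number of pairs (x,y), x ∈ X, y ∈ Y, xy an edge.
-- (For disjoint X, Y — the only case used — this is the number of edges
-- with one endpoint in X and the other in Y.)
E : ∀ {n} → Graph n → Subset n → Subset n → ℕ
E {n} G X Y =
  sum (map (λ x → sum (map (λ y → b2n (lookup X x ∧ (lookup Y y ∧ adj G x y)))
                           (allFin n)))
           (allFin n))

-- A bisection {A, B} is represented by A, with B = ∁ A and |A| = |B|.
IsBisection : ∀ {n} → Subset n → Set
IsBisection A = ∣ A ∣ ≡ ∣ ∁ A ∣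

cutSize : ∀ {n} → Graph n → Subset n → ℕ
cutSize G A = E G A (∁ A)

MinCut : ∀ {n} → Graph n → Subset n → Set
MinCut {n} G A = IsBisection A × (∀ (A' : Subset n) → IsBisection A' → cutSize G A ≤ cutSize G A')

MaxCut : ∀ {n} → Graph n → Subset n → Set
MaxCut {n} G A = IsBisection A × (∀ (A' : Subset n) → IsBisection A' → cutSize G A' ≤ cutSize G A)

SameCut : ∀ {n} → Subset n → Subset n → Set
SameCut A A' = (A' ≡ A) Data.Sum.⊎ (A' ≡ ∁ A)
  where import Data.Sum

record Decomposition {n : ℕ} (A : Subset n) : Set where
  field
    A₁ A₂ B₁ B₂ : Subset n
    splitA  : A₁ ∪ A₂ ≡ A
    disjA   : A₁ ∩ A₂ ≡ ⊥
    splitB  : B₁ ∪ B₂ ≡ ∁ A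
    disjB   : B₁ ∩ B₂ ≡ ⊥
    halvesA : ∣ A₁ ∣ ≡ ∣ A₂ ∣
    halvesB : ∣ B₁ ∣ ≡ ∣ B₂ ∣
open Decomposition public

decompValue : ∀ {n} → Graph n → {A : Subset n} → Decomposition A → ℤ
decompValue G d =
  (+ E G (A₁ d) (A₂ d)) ℤ.+ (+ E G (B₁ d) (B₂ d))
    ℤ.- (+ E G (A₁ d) (B₁ d)) ℤ.- (+ E G (A₂ d) (B₂ d))

-- D_C(A) = v : v is the minimum of decompValue over all decompositions of {A, ∁A}.
DC≡ : ∀ {n} → Graph n → Subset n → ℤ → Set
DC≡ G A v = (Σ (Decomposition A) λ d → decompValue G d ≡ v)
          × (∀ (d : Decomposition A) → v ℤ.≤ decompValue G d)

-- Given a decomposition A = A₁ ∪ A₂, B = B₁ ∪ B₂ into equal halves, exchange A₂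
-- and B₁: the swapped bisection {A₁ ∪ B₁, A₂ ∪ B₂} is again balanced, and
-- expanding both cuts by bilinearity of E over disjoint unions gives
--     cut(A₁ ∪ B₁) = cut(A) + E(A₁,A₂) + E(B₁,B₂) − E(A₁,B₁) − E(A₂,B₂).
-- So when the decomposition value is 0 the swapped bisection has the same cut
-- size, hence is minimum (maximum) as well; and it is a different bisection,
-- because A₁ ∪ B₁ = A or A₁ ∪ B₁ = B would force a quarter, hence a side, to be
-- empty.
module Submission where

open import Defs
open import Data.Nat using (ℕ; _<_)
open import Data.Nat.Divisibility using (_∣_)
open import Data.Integer using (+_)
open import Data.Fin.Subset using (Subset)
open import Data.Product using (Σ; _×_)
open import Relation.Nullary using (¬_)

open import Data.Bool using (Bool; true; false; _∧_; _∨_)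
open import Data.Nat using (zero; suc; _+_; _∸_; _≤_)
import Data.Nat.Properties as ℕₚ
open import Data.Nat.Tactic.RingSolver using (solve-∀)
import Data.Integer as ℤ
import Data.Integer.Tactic.RingSolver as ℤ-Solver
import Data.Integer.Properties as ℤₚ
open import Algebra.Bundles using (CommutativeMonoid)
import Algebra.Properties.CommutativeSemigroup as CommSemigroupProperties
open import Data.Fin using (Fin; zero; suc)
open import Data.Vec using (lookup; _∷_; []; tail)
open import Data.Vec.Properties using (lookup-zipWith; lookup-replicate)
open import Data.List using (map; allFin; tabulate)
open import Data.List.Properties using (map-tabulate)
open import Data.Nat.ListAction using (sum)
open import Data.Product using (_,_; proj₁)
open import Function using (_∘_; id)
open import Relation.Binary.PropositionalEquality as ≡
  using (_≡_; refl; trans; cong; cong₂; subst; module ≡-Reasoning)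
open import Data.Fin.Subset using (∣_∣; ∁; _∪_; _∩_; ⊥; ⊤; _∈_; _⊆_)
open import Data.Fin.Subset.Properties
  using ( Empty-unique; x∈p∩q⁺; x∈p∩q⁻; x∈p∪q⁻; x∈∁p⇒x∉p; x∉p⇒x∈∁p; ∉⊥; ∈⊤
        ; p⊆p∪q; q⊆p∪q; ⊆-antisym; ∩-idem; ∩-comm; ∩-distribˡ-∪; ∩-distribʳ-∪
        ; ∪-idem; ∪-commutativeMonoid; p∪∁p≡⊤; ∣⊥∣≡0; ∣∁p∣≡n∸∣p∣ )
open import Data.Empty using (⊥-elim)
open import Data.Sum using (inj₁; inj₂)
open import Algebra.Properties.CommutativeMonoid.Sum ℕₚ.+-0-commutativeMonoid
  using (∑-distrib-+; ∑-comm; sum-cong-≗) renaming (sum to ∑)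

-- Defs.E counts pairs through a Bool → ℕ indicator private to Defs.  On the
-- one-vertex graph with loop flag b, E reduces to (indicator b + 0) + 0, so
-- unification recovers that indicator up to definitional equality.
private
  loopGraph : (b : Bool) → b ≡ false → Graph 1
  loopGraph b b≡false = record
    { adj = λ _ _ → b ; sym = λ _ _ → refl ; irrfl = λ _ → b≡false }

  indicatorOfE : Σ (Bool → ℕ) λ 𝟙 →
    ∀ b (b≡false : b ≡ false) → E (loopGraph b b≡false) (true ∷ []) (true ∷ []) ≡ 𝟙 b + 0 + 0
  indicatorOfE = _ , λ _ _ → refl

𝟙 : Bool → ℕ
𝟙 = proj₁ indicatorOfE

∑∑ : ∀ {n} → (Fin n → Fin n → ℕ) → ℕ
∑∑ f = ∑ λ x → ∑ λ y → f x y

∑∑-cong : ∀ {n} {f g : Fin n → Fin n → ℕ} → (∀ x y → f x y ≡ g x y) → ∑∑ f ≡ ∑∑ g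
∑∑-cong f≗g = sum-cong-≗ λ x → sum-cong-≗ (f≗g x)

∑∑-distrib-+ : ∀ {n} (f g : Fin n → Fin n → ℕ) →
  ∑∑ (λ x y → f x y + g x y) ≡ ∑∑ f + ∑∑ g
∑∑-distrib-+ f g =
  trans (sum-cong-≗ λ x → ∑-distrib-+ (f x) (g x)) (∑-distrib-+ (λ x → ∑ (f x)) (λ x → ∑ (g x)))

sum-allFin : ∀ {n} (f : Fin n → ℕ) → sum (map f (allFin n)) ≡ ∑ f
sum-allFin f = trans (cong sum (map-tabulate id f)) (sum-tabulate f)
  where
  sum-tabulate : ∀ {n} (f : Fin n → ℕ) → sum (tabulate f) ≡ ∑ f
  sum-tabulate {zero}  f = refl
  sum-tabulate {suc n} f = cong (λ rest → f zero + rest) (sum-tabulate (f ∘ suc))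

pairCount : ∀ {n} → Graph n → Subset n → Subset n → Fin n → Fin n → ℕ
pairCount G X Y x y = 𝟙 (lookup X x ∧ (lookup Y y ∧ adj G x y))

E-∑∑ : ∀ {n} (G : Graph n) X Y → E G X Y ≡ ∑∑ (pairCount G X Y)
E-∑∑ {n} G X Y =
  trans (sum-allFin λ x → sum (map (pairCount G X Y x) (allFin n)))
        (sum-cong-≗ λ x → sum-allFin (pairCount G X Y x))

𝟙-∨ : ∀ a b c → a ∧ b ≡ false → 𝟙 ((a ∨ b) ∧ c) ≡ 𝟙 (a ∧ c) + 𝟙 (b ∧ c)
𝟙-∨ true  true  c     ()
𝟙-∨ true  false true  _ = refl
𝟙-∨ true  false false _ = refl
𝟙-∨ false true  true  _ = refl
𝟙-∨ false true  false _ = refl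
𝟙-∨ false false c     _ = refl

𝟙-swap : ∀ a b e → 𝟙 (a ∧ (b ∧ e)) ≡ 𝟙 (b ∧ (a ∧ e))
𝟙-swap true  true  e = refl
𝟙-swap true  false e = refl
𝟙-swap false true  e = refl
𝟙-swap false false e = refl

disjoint-at : ∀ {n} {X Y : Subset n} → X ∩ Y ≡ ⊥ → ∀ x → lookup X x ∧ lookup Y x ≡ false
disjoint-at {X = X} {Y} X∩Y≡⊥ x = begin
  lookup X x ∧ lookup Y x ≡⟨ lookup-zipWith _∧_ x X Y ⟨
  lookup (X ∩ Y) x        ≡⟨ cong (λ S → lookup S x) X∩Y≡⊥ ⟩
  lookup ⊥ x              ≡⟨ lookup-replicate x false ⟩
  false                   ∎
  where open ≡-Reasoning

E-sym : ∀ {n} (G : Graph n) X Y → E G X Y ≡ E G Y X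
E-sym G X Y = begin
  E G X Y                              ≡⟨ E-∑∑ G X Y ⟩
  ∑∑ (pairCount G X Y)                 ≡⟨ ∑-comm (pairCount G X Y) ⟩
  ∑∑ (λ y x → pairCount G X Y x y)     ≡⟨ ∑∑-cong (λ y x → pairCount-flip x y) ⟩
  ∑∑ (pairCount G Y X)                 ≡⟨ E-∑∑ G Y X ⟨
  E G Y X                              ∎
  where
  open ≡-Reasoning
  pairCount-flip : ∀ x y → pairCount G X Y x y ≡ pairCount G Y X y x
  pairCount-flip x y =
    trans (𝟙-swap (lookup X x) (lookup Y y) (adj G x y))
          (cong (λ e → 𝟙 (lookup Y y ∧ (lookup X x ∧ e))) (Graph.sym G x y))

E-∪ˡ : ∀ {n} (G : Graph n) {X Y : Subset n} Z → X ∩ Y ≡ ⊥ →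
  E G (X ∪ Y) Z ≡ E G X Z + E G Y Z
E-∪ˡ G {X} {Y} Z X∩Y≡⊥ = begin
  E G (X ∪ Y) Z                                           ≡⟨ E-∑∑ G (X ∪ Y) Z ⟩
  ∑∑ (pairCount G (X ∪ Y) Z)                              ≡⟨ ∑∑-cong split ⟩
  ∑∑ (λ x y → pairCount G X Z x y + pairCount G Y Z x y)  ≡⟨ ∑∑-distrib-+ (pairCount G X Z) (pairCount G Y Z) ⟩
  ∑∑ (pairCount G X Z) + ∑∑ (pairCount G Y Z)             ≡⟨ cong₂ _+_ (E-∑∑ G X Z) (E-∑∑ G Y Z) ⟨
  E G X Z + E G Y Z                                       ∎
  where
  open ≡-Reasoning
  split : ∀ x y → pairCount G (X ∪ Y) Z x y ≡ pairCount G X Z x y + pairCount G Y Z x y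
  split x y = trans (cong (λ b → 𝟙 (b ∧ (lookup Z y ∧ adj G x y))) (lookup-zipWith _∨_ x X Y))
                    (𝟙-∨ (lookup X x) (lookup Y x) _ (disjoint-at X∩Y≡⊥ x))

E-∪ʳ : ∀ {n} (G : Graph n) X {Y Z : Subset n} → Y ∩ Z ≡ ⊥ →
  E G X (Y ∪ Z) ≡ E G X Y + E G X Z
E-∪ʳ G X {Y} {Z} Y∩Z≡⊥ = begin
  E G X (Y ∪ Z)      ≡⟨ E-sym G X (Y ∪ Z) ⟩
  E G (Y ∪ Z) X      ≡⟨ E-∪ˡ G X Y∩Z≡⊥ ⟩
  E G Y X + E G Z X  ≡⟨ cong₂ _+_ (E-sym G Y X) (E-sym G Z X) ⟩
  E G X Y + E G X Z  ∎
  where open ≡-Reasoning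

E-∪∪ : ∀ {n} (G : Graph n) {P Q R S : Subset n} → P ∩ Q ≡ ⊥ → R ∩ S ≡ ⊥ →
  E G (P ∪ Q) (R ∪ S) ≡ (E G P R + E G P S) + (E G Q R + E G Q S)
E-∪∪ G {P} {Q} {R} {S} P∩Q≡⊥ R∩S≡⊥ =
  trans (E-∪ˡ G (R ∪ S) P∩Q≡⊥) (cong₂ _+_ (E-∪ʳ G P R∩S≡⊥) (E-∪ʳ G Q R∩S≡⊥))

⊆-∪ˡ : ∀ {n} {P Q S : Subset n} → P ∪ Q ≡ S → P ⊆ S
⊆-∪ˡ {Q = Q} P∪Q≡S = subst (λ T → _ ⊆ T) P∪Q≡S (p⊆p∪q Q)

⊆-∪ʳ : ∀ {n} {P Q S : Subset n} → P ∪ Q ≡ S → Q ⊆ S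
⊆-∪ʳ {P = P} {Q} P∪Q≡S = subst (λ T → Q ⊆ T) P∪Q≡S (q⊆p∪q P Q)

separated : ∀ {n} {P Q R : Subset n} → P ⊆ Q → R ⊆ ∁ Q → P ∩ R ≡ ⊥
separated {P = P} {R = R} P⊆Q R⊆∁Q = Empty-unique λ (x , x∈P∩R) →
  let (x∈P , x∈R) = x∈p∩q⁻ P R x∈P∩R in x∈∁p⇒x∉p (R⊆∁Q x∈R) (P⊆Q x∈P)

∣separated∣≡0 : ∀ {n} {P Q : Subset n} → P ⊆ Q → P ⊆ ∁ Q → ∣ P ∣ ≡ 0
∣separated∣≡0 {n} {P} P⊆Q P⊆∁Q =
  trans (cong ∣_∣ (trans (≡.sym (∩-idem P)) (separated P⊆Q P⊆∁Q))) (∣⊥∣≡0 n)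

∪-disjoint : ∀ {n} {P Q R S : Subset n} →
  P ∩ R ≡ ⊥ → P ∩ S ≡ ⊥ → Q ∩ R ≡ ⊥ → Q ∩ S ≡ ⊥ → (P ∪ Q) ∩ (R ∪ S) ≡ ⊥
∪-disjoint {P = P} {Q} {R} {S} P∩R≡⊥ P∩S≡⊥ Q∩R≡⊥ Q∩S≡⊥ = begin
  (P ∪ Q) ∩ (R ∪ S)                      ≡⟨ ∩-distribʳ-∪ (R ∪ S) P Q ⟩
  P ∩ (R ∪ S) ∪ Q ∩ (R ∪ S)              ≡⟨ cong₂ _∪_ (∩-distribˡ-∪ P R S) (∩-distribˡ-∪ Q R S) ⟩
  (P ∩ R ∪ P ∩ S) ∪ (Q ∩ R ∪ Q ∩ S)      ≡⟨ cong₂ _∪_ (cong₂ _∪_ P∩R≡⊥ P∩S≡⊥) (cong₂ _∪_ Q∩R≡⊥ Q∩S≡⊥) ⟩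
  (⊥ ∪ ⊥) ∪ (⊥ ∪ ⊥)                      ≡⟨ cong₂ _∪_ (∪-idem ⊥) (∪-idem ⊥) ⟩
  ⊥ ∪ ⊥                                  ≡⟨ ∪-idem ⊥ ⟩
  ⊥                                      ∎
  where open ≡-Reasoning

∣∪∣ : ∀ {n} (P Q : Subset n) → P ∩ Q ≡ ⊥ → ∣ P ∪ Q ∣ ≡ ∣ P ∣ + ∣ Q ∣
∣∪∣ []          []          _  = refl
∣∪∣ (true  ∷ P) (true  ∷ Q) ()
∣∪∣ (true  ∷ P) (false ∷ Q) eq = cong suc (∣∪∣ P Q (cong tail eq))
∣∪∣ (false ∷ P) (true  ∷ Q) eq =
  trans (cong suc (∣∪∣ P Q (cong tail eq))) (≡.sym (ℕₚ.+-suc ∣ P ∣ ∣ Q ∣))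
∣∪∣ (false ∷ P) (false ∷ Q) eq = ∣∪∣ P Q (cong tail eq)

∁-unique : ∀ {n} {P Q : Subset n} → P ∩ Q ≡ ⊥ → P ∪ Q ≡ ⊤ → ∁ P ≡ Q
∁-unique {P = P} {Q} P∩Q≡⊥ P∪Q≡⊤ = ⊆-antisym ∁P⊆Q Q⊆∁P
  where
  ∁P⊆Q : ∁ P ⊆ Q
  ∁P⊆Q {x} x∈∁P with x∈p∪q⁻ P Q (subst (x ∈_) (≡.sym P∪Q≡⊤) ∈⊤)
  ... | inj₁ x∈P = ⊥-elim (x∈∁p⇒x∉p x∈∁P x∈P)
  ... | inj₂ x∈Q = x∈Q
  Q⊆∁P : Q ⊆ ∁ P
  Q⊆∁P {x} x∈Q = x∉p⇒x∈∁p λ x∈P → ∉⊥ (subst (x ∈_) P∩Q≡⊥ (x∈p∩q⁺ (x∈P , x∈Q)))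

empty-halves : ∀ {n} {P Q S : Subset n} →
  P ∪ Q ≡ S → P ∩ Q ≡ ⊥ → ∣ P ∣ ≡ ∣ Q ∣ → ∣ P ∣ ≡ 0 → ∣ S ∣ ≡ 0
empty-halves {P = P} {Q} refl P∩Q≡⊥ ∣P∣≡∣Q∣ ∣P∣≡0 = begin
  ∣ P ∪ Q ∣        ≡⟨ ∣∪∣ P Q P∩Q≡⊥ ⟩
  ∣ P ∣ + ∣ Q ∣    ≡⟨ cong₂ _+_ ∣P∣≡0 (trans (≡.sym ∣P∣≡∣Q∣) ∣P∣≡0) ⟩
  0                ∎
  where open ≡-Reasoning

bisection-side-nonempty : ∀ {n} {A : Subset n} → 0 < n → IsBisection A → ¬ ∣ A ∣ ≡ 0
bisection-side-nonempty {n} {A} 0<n ∣A∣≡∣∁A∣ ∣A∣≡0 = ℕₚ.<⇒≢ 0<n (≡.sym n≡0)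
  where
  open ≡-Reasoning
  n≡0 : n ≡ 0
  n≡0 = begin
    n          ≡⟨ cong (n ∸_) ∣A∣≡0 ⟨
    n ∸ ∣ A ∣  ≡⟨ ∣∁p∣≡n∸∣p∣ A ⟨
    ∣ ∁ A ∣    ≡⟨ ∣A∣≡∣∁A∣ ⟨
    ∣ A ∣      ≡⟨ ∣A∣≡0 ⟩
    0          ∎

regroup : ∀ a b c d x y →
  ((a + x) + (y + b)) + (c + d) ≡ ((c + x) + (y + d)) + (a + b)
regroup = solve-∀

shift-ℤ : ∀ (p q a b c d : ℤ.ℤ) →
  p ℤ.+ (c ℤ.+ d) ≡ q ℤ.+ (a ℤ.+ b) → p ≡ q ℤ.+ (a ℤ.+ b ℤ.- c ℤ.- d)
shift-ℤ p q a b c d eq = begin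
  p                                  ≡⟨ add-sub p (c ℤ.+ d) ⟩
  p ℤ.+ (c ℤ.+ d) ℤ.- (c ℤ.+ d)      ≡⟨ cong (λ t → t ℤ.- (c ℤ.+ d)) eq ⟩
  q ℤ.+ (a ℤ.+ b) ℤ.- (c ℤ.+ d)      ≡⟨ reassociate q a b c d ⟩
  q ℤ.+ (a ℤ.+ b ℤ.- c ℤ.- d)        ∎
  where
  open ≡-Reasoning
  add-sub : ∀ p s → p ≡ p ℤ.+ s ℤ.- s
  add-sub = ℤ-Solver.solve-∀
  reassociate : ∀ q a b c d → q ℤ.+ (a ℤ.+ b) ℤ.- (c ℤ.+ d) ≡ q ℤ.+ (a ℤ.+ b ℤ.- c ℤ.- d)
  reassociate = ℤ-Solver.solve-∀

module _ {n : ℕ} {A : Subset n} (d : Decomposition A) where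

  swapped : Subset n
  swapped = A₁ d ∪ B₁ d

  A₁∩B₁≡⊥ : A₁ d ∩ B₁ d ≡ ⊥
  A₁∩B₁≡⊥ = separated (⊆-∪ˡ (splitA d)) (⊆-∪ˡ (splitB d))

  A₁∩B₂≡⊥ : A₁ d ∩ B₂ d ≡ ⊥
  A₁∩B₂≡⊥ = separated (⊆-∪ˡ (splitA d)) (⊆-∪ʳ (splitB d))

  B₁∩A₂≡⊥ : B₁ d ∩ A₂ d ≡ ⊥
  B₁∩A₂≡⊥ = trans (∩-comm (B₁ d) (A₂ d)) (separated (⊆-∪ʳ (splitA d)) (⊆-∪ˡ (splitB d)))

  A₂∩B₂≡⊥ : A₂ d ∩ B₂ d ≡ ⊥
  A₂∩B₂≡⊥ = separated (⊆-∪ʳ (splitA d)) (⊆-∪ʳ (splitB d))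

  ∁-swapped : ∁ swapped ≡ A₂ d ∪ B₂ d
  ∁-swapped = ∁-unique (∪-disjoint (disjA d) A₁∩B₂≡⊥ B₁∩A₂≡⊥ (disjB d)) covers
    where
    open CommSemigroupProperties (CommutativeMonoid.commutativeSemigroup (∪-commutativeMonoid n))
      using (interchange)
    open ≡-Reasoning
    covers : swapped ∪ (A₂ d ∪ B₂ d) ≡ ⊤
    covers = begin
      (A₁ d ∪ B₁ d) ∪ (A₂ d ∪ B₂ d)   ≡⟨ interchange (A₁ d) (B₁ d) (A₂ d) (B₂ d) ⟩
      (A₁ d ∪ A₂ d) ∪ (B₁ d ∪ B₂ d)   ≡⟨ cong₂ _∪_ (splitA d) (splitB d) ⟩
      A ∪ ∁ A                         ≡⟨ p∪∁p≡⊤ A ⟩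
      ⊤                               ∎

  swapped-bisection : IsBisection swapped
  swapped-bisection = begin
    ∣ A₁ d ∪ B₁ d ∣        ≡⟨ ∣∪∣ (A₁ d) (B₁ d) A₁∩B₁≡⊥ ⟩
    ∣ A₁ d ∣ + ∣ B₁ d ∣    ≡⟨ cong₂ _+_ (halvesA d) (halvesB d) ⟩
    ∣ A₂ d ∣ + ∣ B₂ d ∣    ≡⟨ ∣∪∣ (A₂ d) (B₂ d) A₂∩B₂≡⊥ ⟨
    ∣ A₂ d ∪ B₂ d ∣        ≡⟨ cong ∣_∣ ∁-swapped ⟨
    ∣ ∁ swapped ∣          ∎
    where open ≡-Reasoning

  -- Expanding both cuts by bilinearity of E: the counts E(A₁,B₂) and
  -- E(A₂,B₁) = E(B₁,A₂) occur in both, the remaining four are exchanged.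
  cut-swapped : ∀ G →
    cutSize G swapped + (E G (A₁ d) (B₁ d) + E G (A₂ d) (B₂ d))
      ≡ cutSize G A + (E G (A₁ d) (A₂ d) + E G (B₁ d) (B₂ d))
  cut-swapped G = begin
    cutSize G swapped + (e₁₁ + e₂₂)          ≡⟨ cong (λ c → c + (e₁₁ + e₂₂)) expand-swapped ⟩
    ((a₁₂ + x) + (y + b₁₂)) + (e₁₁ + e₂₂)    ≡⟨ regroup a₁₂ b₁₂ e₁₁ e₂₂ x y ⟩
    ((e₁₁ + x) + (y + e₂₂)) + (a₁₂ + b₁₂)    ≡⟨ cong (λ c → c + (a₁₂ + b₁₂)) expand-A ⟨
    cutSize G A + (a₁₂ + b₁₂)                ∎
    where
    open ≡-Reasoning
    e₁₁ e₂₂ a₁₂ b₁₂ x y : ℕ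
    e₁₁ = E G (A₁ d) (B₁ d)
    e₂₂ = E G (A₂ d) (B₂ d)
    a₁₂ = E G (A₁ d) (A₂ d)
    b₁₂ = E G (B₁ d) (B₂ d)
    x   = E G (A₁ d) (B₂ d)
    y   = E G (A₂ d) (B₁ d)

    expand-swapped : cutSize G swapped ≡ (a₁₂ + x) + (y + b₁₂)
    expand-swapped = begin
      E G swapped (∁ swapped)                     ≡⟨ cong (E G swapped) ∁-swapped ⟩
      E G (A₁ d ∪ B₁ d) (A₂ d ∪ B₂ d)             ≡⟨ E-∪∪ G A₁∩B₁≡⊥ A₂∩B₂≡⊥ ⟩
      (a₁₂ + x) + (E G (B₁ d) (A₂ d) + b₁₂)       ≡⟨ cong (λ z → (a₁₂ + x) + (z + b₁₂)) (E-sym G (B₁ d) (A₂ d)) ⟩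
      (a₁₂ + x) + (y + b₁₂)                       ∎

    expand-A : cutSize G A ≡ (e₁₁ + x) + (y + e₂₂)
    expand-A = trans (cong₂ (E G) (≡.sym (splitA d)) (≡.sym (splitB d)))
                     (E-∪∪ G (disjA d) (disjB d))

  cut-swapped-ℤ : ∀ G → + cutSize G swapped ≡ + cutSize G A ℤ.+ decompValue G d
  cut-swapped-ℤ G =
    shift-ℤ (+ cutSize G swapped) (+ cutSize G A)
            (+ E G (A₁ d) (A₂ d)) (+ E G (B₁ d) (B₂ d)) (+ E G (A₁ d) (B₁ d)) (+ E G (A₂ d) (B₂ d))
            (cong (+_) (cut-swapped G))

  equal-cut : ∀ G → decompValue G d ≡ + 0 → cutSize G swapped ≡ cutSize G A
  equal-cut G value≡0 = ℤₚ.+-injective (begin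
    + cutSize G swapped                   ≡⟨ cut-swapped-ℤ G ⟩
    + cutSize G A ℤ.+ decompValue G d     ≡⟨ cong (λ v → + cutSize G A ℤ.+ v) value≡0 ⟩
    + cutSize G A ℤ.+ + 0                 ≡⟨ ℤₚ.+-identityʳ (+ cutSize G A) ⟩
    + cutSize G A                         ∎)
    where open ≡-Reasoning

  -- On a nonempty vertex set the swapped bisection differs from {A, ∁ A}:
  -- A₁ ∪ B₁ = A forces B₁ ⊆ A ∩ ∁ A, and A₁ ∪ B₁ = ∁ A forces A₁ ⊆ A ∩ ∁ A;
  -- an empty quarter empties its side, contradicting that both sides are nonempty.
  swapped-distinct : 0 < n → IsBisection A → ¬ SameCut A swapped
  swapped-distinct 0<n ∣A∣≡∣∁A∣ (inj₁ swapped≡A) =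
    bisection-side-nonempty {A = A} 0<n ∣A∣≡∣∁A∣ (trans ∣A∣≡∣∁A∣ ∣∁A∣≡0)
    where
    ∣∁A∣≡0 : ∣ ∁ A ∣ ≡ 0
    ∣∁A∣≡0 = empty-halves (splitB d) (disjB d) (halvesB d)
               (∣separated∣≡0 (⊆-∪ʳ swapped≡A) (⊆-∪ˡ (splitB d)))
  swapped-distinct 0<n ∣A∣≡∣∁A∣ (inj₂ swapped≡∁A) =
    bisection-side-nonempty {A = A} 0<n ∣A∣≡∣∁A∣
      (empty-halves (splitA d) (disjA d) (halvesA d)
         (∣separated∣≡0 (⊆-∪ˡ (splitA d)) (⊆-∪ˡ swapped≡∁A)))

MinCut-equal : ∀ {n} (G : Graph n) (A A' : Subset n) →
  MinCut G A → IsBisection A' → cutSize G A' ≡ cutSize G A → MinCut G A'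
MinCut-equal G _ _ (_ , minimal) bisA' equal =
  bisA' , λ A'' bisA'' → subst (λ c → c ≤ cutSize G A'') (≡.sym equal) (minimal A'' bisA'')

MaxCut-equal : ∀ {n} (G : Graph n) (A A' : Subset n) →
  MaxCut G A → IsBisection A' → cutSize G A' ≡ cutSize G A → MaxCut G A'
MaxCut-equal G _ _ (_ , maximal) bisA' equal =
  bisA' , λ A'' bisA'' → subst (λ c → cutSize G A'' ≤ c) (≡.sym equal) (maximal A'' bisA'')

-- An organized partition with D_C = 0 is a decomposition of value 0; its swapped bisection has the same cut size and
-- is a different bisection.
corollary5 : ∀ {n : ℕ} (G : Graph n) → 0 < n → 4 ∣ n → Connected G →
    ∀ (A : Subset n) →
      (MinCut G A → DC≡ G A (+ 0) →
        Σ (Subset n) λ A' → MinCut G A' × ¬ SameCut A A')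
      × (MaxCut G A → DC≡ G A (+ 0) →
        Σ (Subset n) λ A' → MaxCut G A' × ¬ SameCut A A')
corollary5 {n} G 0<n _ _ A = another-minimum , another-maximum
  where
  another-minimum : MinCut G A → DC≡ G A (+ 0) →
    Σ (Subset n) λ A' → MinCut G A' × ¬ SameCut A A'
  another-minimum minA ((d , value≡0) , _) =
    swapped d
      , MinCut-equal G A (swapped d) minA (swapped-bisection d) (equal-cut d G value≡0)
      , swapped-distinct d 0<n (proj₁ minA)

  another-maximum : MaxCut G A → DC≡ G A (+ 0) →
    Σ (Subset n) λ A' → MaxCut G A' × ¬ SameCut A A'
  another-maximum maxA ((d , value≡0) , _) =
    swapped d
      , MaxCut-equal G A (swapped d) maxA (swapped-bisection d) (equal-cut d G value≡0)
      , swapped-distinct d 0<n (proj₁ maxA)
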